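{- For every graph $G\neq K_1$, $\tilde\gamma_{w2}(G)\le 2\gamma_{w2}(G)-2$.
   Context: $G=(V,E)$ finite simple graph, $N(v)$ open neighborhood. $\gamma_{w2}(G)$ is the minimum of $\sum_v f(v)$ over $f:V\to\{0,1,2\}$ such that $\sum_{w\in N(v)}f(w)\ge 2$ for every $v$ with $f(v)=0$. $\tilde\gamma_{w2}(G)$ is the minimum of $\sum_v|f(v)|$ over $f:V\to\mathcal P(\{a,b\})$ such that $\bigcup_{w\in N(v)}f(w)=\{a,b\}$ for every $v$ with $f(v)=\emptyset$. -}

module Defs where

open import Data.Nat using (ℕ; zero; suc; _+_; _*_; _≤_)
open import Data.Fin using (Fin)
open import Data.List using (List; map; filter; allFin)
open import Data.Nat.ListAction using (sum)
open import Data.Product using (Σ; _×_; ∃)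
open import Relation.Nullary using (Dec; ¬_)
open import Relation.Binary.PropositionalEquality using (_≡_)
open import Relation.Binary using (Decidable)
import Data.Fin.Subset as S

record Graph : Set₁ where
  field
    n     : ℕ
    Adj   : Fin n → Fin n → Set
    adj?  : Decidable Adj
    sym   : ∀ {u v} → Adj u v → Adj v u
    irrefl : ∀ {v} → ¬ Adj v v

open Graph public

N : (G : Graph) → Fin (n G) → List (Fin (n G))
N G v = filter (adj? G v) (allFin (n G))

IsW2DF : (G : Graph) → (Fin (n G) → ℕ) → Set
IsW2DF G f = (∀ v → f v ≤ 2)
           × (∀ v → f v ≡ 0 → 2 ≤ sum (map f (N G v)))

weight : (G : Graph) → (Fin (n G) → ℕ) → ℕ
weight G f = sum (map f (allFin (n G)))

IsGammaW2 : Graph → ℕ → Set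
IsGammaW2 G k = (Σ (Fin (n G) → ℕ) λ f → IsW2DF G f × weight G f ≡ k)
              × (∀ f → IsW2DF G f → k ≤ weight G f)

-- set-valued version: f : V → P({a,b}), P({a,b}) = Subset 2
IsW2RDF : (G : Graph) → (Fin (n G) → S.Subset 2) → Set
IsW2RDF G f = ∀ v → f v ≡ S.⊥ → S.⋃ (map f (N G v)) ≡ S.⊤

setWeight : (G : Graph) → (Fin (n G) → S.Subset 2) → ℕ
setWeight G f = sum (map (λ v → S.∣ f v ∣) (allFin (n G)))

IsGammaTildeW2 : Graph → ℕ → Set
IsGammaTildeW2 G k = (Σ (Fin (n G) → S.Subset 2) λ f → IsW2RDF G f × setWeight G f ≡ k)
                   × (∀ f → IsW2RDF G f → k ≤ setWeight G f)

-- Let f be a minimum weak 2-dominating function and choose, for each of the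
-- two colours, an anchor vertex (possibly the same for both) such that the
-- anchors lie under f: every vertex v is an anchor at most f v times.  The
-- set-valued function  split  gives v a colour iff f v exceeds the number of
-- times v is the anchor of that colour.  Then
--   * |split v| + (number of anchors at v) ≤ 2 f v, so summing over all
--     vertices gives weight(split) + 2 ≤ 2 weight(f);
--   * split is weak 2-rainbow dominating: split v = ∅ forces f v = 0, so
--     N(v) carries f-mass ≥ 2 while an anchor occurs in N(v) at most once;
--     hence some neighbour exceeds its anchor count and keeps the colour;
--   * anchors exist: a duplicate-free vertex list of f-mass ≥ 2 exists (the
--     neighbourhood of a vertex of value 0, or two vertices of positive
--     value), and the same counting argument extracts the anchors from it.
module Submission where

open import Defs hiding (sym)
open import Data.Nat using (ℕ; zero; suc; _+_; _*_; _≤_; _<_; _<ᵇ_; _≟_; _<?_; z≤n; s≤s)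
open import Data.Nat.Properties
open import Algebra.Properties.CommutativeSemigroup +-commutativeSemigroup using (interchange)
open import Data.Bool using (Bool; true; false)
open import Data.Bool.Properties using (T-≡)
open import Data.Fin using (Fin; zero; suc) renaming (_≟_ to _≟ᶠ_)
open import Data.List using (List; []; _∷_; map; allFin)
open import Data.Nat.ListAction using (sum)
open import Data.Vec using (tabulate; []; _∷_)
open import Data.Vec.Properties using (lookup⇒[]=; lookup∘tabulate)
open import Data.Product using (Σ; _×_; _,_; proj₂)
open import Data.Sum using (inj₁; inj₂)
open import Relation.Nullary using (yes; no; ¬_; does; contradiction)
open import Relation.Binary.Definitions using (DecidableEquality)
open import Relation.Binary.PropositionalEquality using (_≡_; refl; sym; trans; cong; subst)
open import Function.Bundles using (Equivalence)
open import Data.List.Membership.Propositional using (_∈_)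
open import Data.List.Membership.Propositional.Properties using (∈-allFin)
open import Data.List.Relation.Unary.Any using (here; there)
open import Data.List.Relation.Unary.All using (All; []; _∷_)
open import Data.List.Relation.Unary.AllPairs using ([]; _∷_)
open import Data.List.Relation.Unary.Unique.Propositional using (Unique)
import Data.List.Relation.Unary.Unique.Propositional.Properties as Unique
import Data.Fin.Subset as S
open import Data.Fin.Subset.Properties using (⊆-antisym; ⊆⊤; x∈p∪q⁺)

bit : Bool → ℕ
bit false = 0
bit true  = 1

module _ {A : Set} where

  sum-map-+ : (g h : A → ℕ) (xs : List A) →
              sum (map (λ x → g x + h x) xs) ≡ sum (map g xs) + sum (map h xs)
  sum-map-+ g h [] = refl
  sum-map-+ g h (x ∷ xs) =
    trans (cong (g x + h x +_) (sum-map-+ g h xs))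
          (interchange (g x) (h x) (sum (map g xs)) (sum (map h xs)))

  sum-map-*ˡ : (c : ℕ) (g : A → ℕ) (xs : List A) →
               sum (map (λ x → c * g x) xs) ≡ c * sum (map g xs)
  sum-map-*ˡ c g [] = sym (*-zeroʳ c)
  sum-map-*ˡ c g (x ∷ xs) =
    trans (cong (c * g x +_) (sum-map-*ˡ c g xs)) (sym (*-distribˡ-+ c (g x) _))

  sum-map-mono : {g h : A → ℕ} → (∀ x → g x ≤ h x) → (xs : List A) →
                 sum (map g xs) ≤ sum (map h xs)
  sum-map-mono g≤h [] = z≤n
  sum-map-mono g≤h (x ∷ xs) = +-mono-≤ (g≤h x) (sum-map-mono g≤h xs)

  exceeds-somewhere : (g h : A → ℕ) (xs : List A) →
                      sum (map g xs) < sum (map h xs) → Σ A λ w → w ∈ xs × g w < h w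
  exceeds-somewhere g h [] ()
  exceeds-somewhere g h (x ∷ xs) total with g x <? h x
  ... | yes gx<hx = x , here refl , gx<hx
  ... | no gx≮hx =
    let (w , w∈xs , gw<hw) = exceeds-somewhere g h xs tail<
    in w , there w∈xs , gw<hw
    where
    open ≤-Reasoning
    tail< : sum (map g xs) < sum (map h xs)
    tail< = +-cancelˡ-< (g x) _ _ (begin-strict
      g x + sum (map g xs) <⟨ total ⟩
      h x + sum (map h xs) ≤⟨ +-monoˡ-≤ _ (≮⇒≥ gx≮hx) ⟩
      g x + sum (map h xs) ∎)

module _ {A : Set} (_≟ᴬ_ : DecidableEquality A) where

  hits : A → A → ℕ
  hits u v = bit (does (v ≟ᴬ u))

  hits-self : (u : A) → hits u u ≡ 1
  hits-self u with u ≟ᴬ u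
  ... | yes _ = refl
  ... | no u≢u = contradiction refl u≢u

  hits-other : (u v : A) → ¬ v ≡ u → hits u v ≡ 0
  hits-other u v v≢u with v ≟ᴬ u
  ... | yes v≡u = contradiction v≡u v≢u
  ... | no _ = refl

  hits-absent : (u : A) (xs : List A) → All (λ x → ¬ u ≡ x) xs → sum (map (hits u) xs) ≡ 0
  hits-absent u [] [] = refl
  hits-absent u (x ∷ xs) (u≢x ∷ rest) with x ≟ᴬ u
  ... | yes x≡u = contradiction (sym x≡u) u≢x
  ... | no _ = hits-absent u xs rest

  hits-unique : (u : A) (xs : List A) → Unique xs → sum (map (hits u) xs) ≤ 1
  hits-unique u [] [] = z≤n
  hits-unique u (x ∷ xs) (x∉xs ∷ uniq) with x ≟ᴬ u
  ... | yes refl = ≤-reflexive (cong suc (hits-absent x xs x∉xs))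
  ... | no _ = hits-unique u xs uniq

  hits-member : (u : A) (xs : List A) → u ∈ xs → 1 ≤ sum (map (hits u) xs)
  hits-member u (x ∷ xs) (here refl) = ≤-trans (≤-reflexive (sym (hits-self x))) (m≤m+n _ _)
  hits-member u (x ∷ xs) (there u∈xs) = ≤-trans (hits-member u xs u∈xs) (m≤n+m _ _)

  -- Mass at least 2 on a duplicate-free list cannot all be absorbed by one
  -- anchor: some element w carries more than hits u w.
  unanchored-mass : (f : A → ℕ) (xs : List A) → Unique xs → 2 ≤ sum (map f xs) →
                    (u : A) → Σ A λ w → w ∈ xs × hits u w < f w
  unanchored-mass f xs uniq mass u =
    exceeds-somewhere (hits u) f xs (≤-trans (s≤s (hits-unique u xs uniq)) mass)

  LiesUnder : (A → ℕ) → A → A → Set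
  LiesUnder f a b = ∀ v → hits a v + hits b v ≤ f v

  lies-under : (f : A → ℕ) (a b : A) → 1 ≤ f a → hits a b < f b → LiesUnder f a b
  lies-under f a b fa>0 b-free v with v ≟ᴬ a | v ≟ᴬ b
  ... | yes refl | yes refl = subst (_< f v) (hits-self v) b-free
  ... | yes refl | no _     = fa>0
  ... | no v≢a   | yes refl = subst (_< f v) (hits-other a v v≢a) b-free
  ... | no _     | no _     = z≤n

  anchors-from-mass : (f : A → ℕ) (xs : List A) → Unique xs → 2 ≤ sum (map f xs) →
                      Σ A λ a → Σ A λ b → LiesUnder f a b
  anchors-from-mass f [] [] ()
  anchors-from-mass f (x ∷ xs) uniq mass =
    let (a , _ , a-free) = unanchored-mass f (x ∷ xs) uniq mass x
        (b , _ , b-free) = unanchored-mass f (x ∷ xs) uniq mass a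
    in a , b , lies-under f a b (≤-trans (s≤s z≤n) a-free) b-free

-- A vertex of value m which is the anchor of a colour bit b times keeps that
-- colour iff bit b < m.
kept : ℕ → Bool → Bool
kept m b = bit b <ᵇ m

kept-heavy : ∀ m b → kept (suc (suc m)) b ≡ true
kept-heavy m false = refl
kept-heavy m true  = refl

vertex-charge : (m : ℕ) (b₀ b₁ : Bool) → bit b₀ + bit b₁ ≤ m →
                S.∣ kept m b₀ ∷ kept m b₁ ∷ [] ∣ + (bit b₀ + bit b₁) ≤ 2 * m
vertex-charge zero false false _ = z≤n
vertex-charge (suc zero) false false _ = ≤-refl
vertex-charge (suc zero) false true _ = ≤-refl
vertex-charge (suc zero) true false _ = ≤-refl
vertex-charge (suc zero) true true (s≤s ())
vertex-charge (suc (suc m)) b₀ b₁ _ rewrite kept-heavy m b₀ | kept-heavy m b₁ =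
  ≤-trans (+-monoʳ-≤ 2 (bits≤2 b₀ b₁)) (*-monoʳ-≤ 2 (s≤s (s≤s z≤n)))
  where
  bits≤2 : ∀ c₀ c₁ → bit c₀ + bit c₁ ≤ 2
  bits≤2 false false = z≤n
  bits≤2 false true = s≤s z≤n
  bits≤2 true false = s≤s z≤n
  bits≤2 true true = ≤-refl

vertex-nonempty : (m : ℕ) (b₀ b₁ : Bool) → bit b₀ + bit b₁ ≤ m →
                  kept m b₀ ∷ kept m b₁ ∷ [] ≡ S.⊥ → m ≡ 0
vertex-nonempty zero _ _ _ _ = refl
vertex-nonempty (suc zero) false false _ ()
vertex-nonempty (suc zero) false true _ ()
vertex-nonempty (suc zero) true false _ ()
vertex-nonempty (suc zero) true true (s≤s ()) _
vertex-nonempty (suc (suc m)) false false _ ()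
vertex-nonempty (suc (suc m)) false true _ ()
vertex-nonempty (suc (suc m)) true false _ ()
vertex-nonempty (suc (suc m)) true true _ ()

N-unique : (G : Graph) (v : Fin (n G)) → Unique (N G v)
N-unique G v = Unique.filter⁺ (adj? G v) (Unique.allFin⁺ (n G))

∈-⋃ : ∀ {m} {A : Set} (g : A → S.Subset m) {w : A} {xs : List A} {i : Fin m} →
      w ∈ xs → i S.∈ g w → i S.∈ S.⋃ (map g xs)
∈-⋃ g (here refl) i∈gw = x∈p∪q⁺ (inj₁ i∈gw)
∈-⋃ g (there w∈xs) i∈gw = x∈p∪q⁺ (inj₂ (∈-⋃ g w∈xs i∈gw))

module Split (G : Graph) (f : Fin (n G) → ℕ) (a b : Fin (n G)) where

  anchor : Fin 2 → Fin (n G)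
  anchor zero = a
  anchor (suc zero) = b

  keeps? : Fin (n G) → Fin 2 → Bool
  keeps? v i = kept (f v) (does (v ≟ᶠ anchor i))

  split : Fin (n G) → S.Subset 2
  split v = tabulate (keeps? v)

  keeps : ∀ {i} w → hits _≟ᶠ_ (anchor i) w < f w → i S.∈ split w
  keeps {i} w free =
    lookup⇒[]= i (split w)
      (trans (lookup∘tabulate (keeps? w) i) (Equivalence.to T-≡ (<⇒<ᵇ free)))

  split-valid : LiesUnder _≟ᶠ_ f a b → IsW2DF G f → IsW2RDF G split
  split-valid under wf v empty = ⊆-antisym ⊆⊤ (λ {i} _ → covered i)
    where
    fv≡0 : f v ≡ 0
    fv≡0 = vertex-nonempty (f v) _ _ (under v) empty
    covered : ∀ i → i S.∈ S.⋃ (map split (N G v))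
    covered i =
      let (w , w∈N , free) = unanchored-mass _≟ᶠ_ f (N G v) (N-unique G v)
                                             (proj₂ wf v fv≡0) (anchor i)
      in ∈-⋃ split w∈N (keeps w free)

  -- Summing vertex-charge: the two anchors account for the saving of 2.
  split-weight : LiesUnder _≟ᶠ_ f a b → setWeight G split + 2 ≤ 2 * weight G f
  split-weight under = begin
    setWeight G split + 2
      ≤⟨ +-monoʳ-≤ (setWeight G split) (+-mono-≤ (anchored a) (anchored b)) ⟩
    setWeight G split + (sum (map (hits _≟ᶠ_ a) vs) + sum (map (hits _≟ᶠ_ b) vs))
      ≡⟨ cong (setWeight G split +_) (sum-map-+ (hits _≟ᶠ_ a) (hits _≟ᶠ_ b) vs) ⟨
    setWeight G split + sum (map load vs)
      ≡⟨ sum-map-+ (λ v → S.∣ split v ∣) load vs ⟨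
    sum (map (λ v → S.∣ split v ∣ + load v) vs)
      ≤⟨ sum-map-mono (λ v → vertex-charge (f v) _ _ (under v)) vs ⟩
    sum (map (λ v → 2 * f v) vs)
      ≡⟨ sum-map-*ˡ 2 f vs ⟩
    2 * weight G f ∎
    where
    open ≤-Reasoning
    vs : List (Fin (n G))
    vs = allFin (n G)
    load : Fin (n G) → ℕ
    load v = hits _≟ᶠ_ a v + hits _≟ᶠ_ b v
    anchored : ∀ u → 1 ≤ sum (map (hits _≟ᶠ_ u) vs)
    anchored u = hits-member _≟ᶠ_ u vs (∈-allFin u)

two-vertices : ∀ {m} → 2 ≤ m → Σ (Fin m) λ x → Σ (Fin m) λ y → ¬ x ≡ y
two-vertices {suc zero} (s≤s ())
two-vertices {suc (suc m)} _ = zero , suc zero , λ ()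

massive-list : (G : Graph) (f : Fin (n G) → ℕ) → IsW2DF G f →
               (v₀ v₁ : Fin (n G)) → ¬ v₀ ≡ v₁ →
               Σ (List (Fin (n G))) λ xs → Unique xs × 2 ≤ sum (map f xs)
massive-list G f wf v₀ v₁ v₀≢v₁ with f v₀ ≟ 0 | f v₁ ≟ 0
... | yes f₀≡0 | _ = N G v₀ , N-unique G v₀ , proj₂ wf v₀ f₀≡0
... | no _ | yes f₁≡0 = N G v₁ , N-unique G v₁ , proj₂ wf v₁ f₁≡0
... | no f₀≢0 | no f₁≢0 =
  v₀ ∷ v₁ ∷ [] , (v₀≢v₁ ∷ []) ∷ [] ∷ [] ,
  +-mono-≤ (n≢0⇒n>0 f₀≢0) (+-mono-≤ (n≢0⇒n>0 f₁≢0) z≤n)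

mainTheorem11 : (G : Graph) → 2 ≤ n G → (k k̃ : ℕ) →
    IsGammaW2 G k → IsGammaTildeW2 G k̃ → k̃ + 2 ≤ 2 * k
mainTheorem11 G two k k̃ ((f , wf , refl) , _) (_ , minimal) =
  let (v₀ , v₁ , v₀≢v₁) = two-vertices two
      (xs , uniq , mass) = massive-list G f wf v₀ v₁ v₀≢v₁
      (a , b , under) = anchors-from-mass _≟ᶠ_ f xs uniq mass
      open Split G f a b
  in ≤-trans (+-monoˡ-≤ 2 (minimal split (split-valid under wf))) (split-weight under)
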